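{- Let $N \geq 11$. Every 2-connected graph $G$ with at most $N$ vertices and more than $1+\log_2(N!)$ edges is edge reconstructible.
   Context: All graphs are finite and simple. A connected graph $G$ is 2-connected if there is no vertex $x$ such that $G-x$ is disconnected or a single vertex. The edge deck of a graph $G$ is the multiset of unlabeled graphs $\{G-e : e \in E(G)\}$. A graph $G$ is edge reconstructible if every graph with the same edge deck as $G$ is isomorphic to $G$. -}

module Defs where

open import Data.Nat using (ℕ; suc; _≤_; _<_)
open import Data.Fin using (Fin; _≟_) renaming (_<_ to _<ᶠ_)
open import Data.Bool using (Bool; true; false; _∧_; _∨_; not)
open import Data.Bool.Properties using (∧-comm; ∨-comm)
open import Data.List using (List; map; allFin)
open import Data.Nat.ListAction using (sum)
open import Data.Product using (Σ; _×_; _,_; proj₁; proj₂)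
open import Data.Unit using (⊤)
open import Function.Bundles using (_↔_; Inverse)
open import Relation.Nullary using (¬_)
open import Relation.Nullary.Decidable using (⌊_⌋)
open import Relation.Binary.PropositionalEquality using (_≡_; refl; cong)
open import Data.Fin using (_<?_)

record Graph : Set where
  field
    n      : ℕ
    adj    : Fin n → Fin n → Bool
    sym    : ∀ i j → adj i j ≡ adj j i
    irrefl : ∀ i → adj i i ≡ false
open Graph public

Edge : Graph → Set
Edge G = Σ (Fin (n G) × Fin (n G)) λ p → (proj₁ p <ᶠ proj₂ p) × (adj G (proj₁ p) (proj₂ p) ≡ true)

edgeIndicator : (G : Graph) → Fin (n G) → Fin (n G) → ℕ
edgeIndicator G i j with ⌊ i <? j ⌋ ∧ adj G i j
... | true  = 1
... | false = 0

numEdges : Graph → ℕ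
numEdges G = sum (map (λ i → sum (map (λ j → edgeIndicator G i j) (allFin (n G)))) (allFin (n G)))

_≅_ : Graph → Graph → Set
G ≅ H = Σ (Fin (n G) ↔ Fin (n H)) λ f →
          ∀ i j → adj G i j ≡ adj H (Inverse.to f i) (Inverse.to f j)

matches : ∀ {m} → Fin m → Fin m → Fin m → Fin m → Bool
matches a b i j = (⌊ i ≟ a ⌋ ∧ ⌊ j ≟ b ⌋) ∨ (⌊ i ≟ b ⌋ ∧ ⌊ j ≟ a ⌋)

matches-sym : ∀ {m} (a b i j : Fin m) → matches a b i j ≡ matches a b j i
matches-sym a b i j
  rewrite ∧-comm ⌊ i ≟ a ⌋ ⌊ j ≟ b ⌋ | ∧-comm ⌊ i ≟ b ⌋ ⌊ j ≟ a ⌋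
  = ∨-comm (⌊ j ≟ b ⌋ ∧ ⌊ i ≟ a ⌋) (⌊ j ≟ a ⌋ ∧ ⌊ i ≟ b ⌋)

deleteEdge : (G : Graph) → Edge G → Graph
deleteEdge G ((a , b) , _) = record
  { n      = n G
  ; adj    = λ i j → adj G i j ∧ not (matches a b i j)
  ; sym    = λ i j → prf i j
  ; irrefl = λ i → irr i
  }
  where
  prf : ∀ i j → (adj G i j ∧ not (matches a b i j)) ≡ (adj G j i ∧ not (matches a b j i))
  prf i j rewrite sym G i j | matches-sym a b i j = refl
  irr : ∀ i → (adj G i i ∧ not (matches a b i i)) ≡ false
  irr i rewrite irrefl G i = refl

-- Same edge deck: a bijection φ : E(G) → E(H) with G - e ≅ H - φ(e)
-- (equality of the multisets of isomorphism classes of edge-deleted subgraphs).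
SameEdgeDeck : Graph → Graph → Set
SameEdgeDeck G H = Σ (Edge G ↔ Edge H) λ φ →
  ∀ e → deleteEdge G e ≅ deleteEdge H (Inverse.to φ e)

EdgeReconstructible : Graph → Set
EdgeReconstructible G = (H : Graph) → SameEdgeDeck G H → G ≅ H

data Walk (G : Graph) (ok : Fin (n G) → Set) : Fin (n G) → Fin (n G) → Set where
  here : ∀ {i} → ok i → Walk G ok i i
  step : ∀ {i j k} → ok i → adj G i j ≡ true → Walk G ok j k → Walk G ok i k

Connected : Graph → Set
Connected G = (1 ≤ n G) × (∀ i j → Walk G (λ _ → ⊤) i j)

ConnectedWithout : (G : Graph) → Fin (n G) → Set
ConnectedWithout G x = ∀ i j → ¬ (i ≡ x) → ¬ (j ≡ x) → Walk G (λ v → ¬ (v ≡ x)) i j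

-- 2-connected: connected, and no vertex x with G - x disconnected or a single
-- vertex (so in particular at least 3 vertices).
TwoConnected : Graph → Set
TwoConnected G = Connected G × (3 ≤ n G) × (∀ x → ConnectedWithout G x)

-- Müller's counting argument. Let H have the same edge deck as G, so H also has n vertices and
-- m edges, and fix a bijection α : V(G) → V(H). A pattern assigns to each edge of G one of `on`,
-- `off`, `free`; count the permutations π of V(G) whose images of the edges of G are edges of G
-- (resp. whose composites α ∘ π give edges of H) exactly at the `on` positions and non-edges at
-- the `off` positions. For patterns with no `off` and some `free` entry, Kelly's lemma determines
-- the count for G from the counts for the cards G - e, so G and H agree there. Splitting
-- `free` = `on` + `off` then shows that on fully specified patterns the two counts differ by ±a,
-- with the sign given by the parity of the number of `off` entries and a the difference of the
-- all-`on` counts. Unless some α ∘ π carries E(G) into E(H), which makes it an isomorphism, a ≥ 1;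
-- then each of the 2^(m-1) patterns with an even number of `off` entries is realised by some
-- permutation of V(G), so 2^(m-1) ≤ n!. The edge bound excludes this.

module Submission where

open import Defs hiding (sym)
open import Data.Nat using (ℕ; zero; suc; _+_; _*_; _∸_; _^_; _!; _≤_; _<_; z≤n; s≤s; >-nonZero)
open import Data.Nat.Properties
open import Data.Fin using (Fin; zero; suc; punchIn; punchOut) renaming (_<_ to _<ᶠ_)
import Data.Fin as F
import Data.Fin.Properties as FP
import Data.Fin.Permutation as Permutation
open import Data.Bool using (Bool; true; false; _∧_; _∨_; not)
import Data.Bool.Properties as BP
open import Data.List using (List; []; _∷_; _++_; map; concatMap; cartesianProduct; length; allFin; tabulate)
open import Data.List.Properties using (length-tabulate)
open import Data.Nat.ListAction using (sum)
open import Data.Vec using (Vec; []; _∷_; replicate; head; tail)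
open import Data.Product using (Σ; _×_; _,_; proj₁; proj₂)
import Data.Product.Properties as PP
open import Data.Sum using (_⊎_; inj₁; inj₂)
open import Data.Unit using (⊤; tt)
open import Data.Empty using (⊥; ⊥-elim)
open import Function.Bundles using (_↔_; Inverse; Injection; mk↔ₛ′)
open import Function.Properties.Inverse using (↔-sym; ↔⇒↣)
open import Function.Definitions using (Injective)
open import Function.Construct.Composition using (_↔-∘_)
open import Relation.Nullary using (¬_; Dec; yes; no)
open import Relation.Nullary.Decidable using (⌊_⌋; _×-dec_; map′)
open import Relation.Binary.Definitions using (DecidableEquality; tri<; tri≈; tri>)
open import Relation.Binary.PropositionalEquality using (_≡_; _≢_; refl; sym; trans; cong; cong₂; subst)
open import Axiom.UniquenessOfIdentityProofs using (module Decidable⇒UIP)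
open Relation.Binary.PropositionalEquality.≡-Reasoning

Σl : ∀ {A : Set} → List A → (A → ℕ) → ℕ
Σl xs f = sum (map f xs)

module _ {A : Set} where
  Σl-cong : ∀ (xs : List A) {f g : A → ℕ} → (∀ x → f x ≡ g x) → Σl xs f ≡ Σl xs g
  Σl-cong [] e = refl
  Σl-cong (x ∷ xs) e = cong₂ _+_ (e x) (Σl-cong xs e)

  Σl-+ : ∀ (xs : List A) (f g : A → ℕ) → Σl xs (λ x → f x + g x) ≡ Σl xs f + Σl xs g
  Σl-+ [] f g = refl
  Σl-+ (x ∷ xs) f g = begin
    f x + g x + Σl xs (λ x → f x + g x) ≡⟨ cong (f x + g x +_) (Σl-+ xs f g) ⟩
    f x + g x + (Σl xs f + Σl xs g)     ≡⟨ +-assoc (f x) (g x) _ ⟩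
    f x + (g x + (Σl xs f + Σl xs g))   ≡⟨ cong (f x +_) (+-comm (g x) _) ⟩
    f x + ((Σl xs f + Σl xs g) + g x)   ≡⟨ cong (f x +_) (+-assoc (Σl xs f) _ _) ⟩
    f x + (Σl xs f + (Σl xs g + g x))   ≡⟨ cong (λ z → f x + (Σl xs f + z)) (+-comm (Σl xs g) (g x)) ⟩
    f x + (Σl xs f + (g x + Σl xs g))   ≡⟨ sym (+-assoc (f x) _ _) ⟩
    f x + Σl xs f + (g x + Σl xs g)     ∎

  Σl-*ʳ : ∀ (xs : List A) (f : A → ℕ) k → Σl xs (λ x → f x * k) ≡ Σl xs f * k
  Σl-*ʳ [] f k = refl
  Σl-*ʳ (x ∷ xs) f k = trans (cong (f x * k +_) (Σl-*ʳ xs f k)) (sym (*-distribʳ-+ k (f x) _))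

  Σl-*ˡ : ∀ (xs : List A) (f : A → ℕ) k → Σl xs (λ x → k * f x) ≡ k * Σl xs f
  Σl-*ˡ xs f k = trans (Σl-cong xs (λ x → *-comm k (f x))) (trans (Σl-*ʳ xs f k) (*-comm _ k))

  Σl-zero : ∀ (xs : List A) → Σl xs (λ _ → 0) ≡ 0
  Σl-zero [] = refl
  Σl-zero (x ∷ xs) = Σl-zero xs

  Σl-const : ∀ (xs : List A) c → Σl xs (λ _ → c) ≡ length xs * c
  Σl-const [] c = refl
  Σl-const (x ∷ xs) c = cong (c +_) (Σl-const xs c)

  Σl-mono-≤ : ∀ (xs : List A) {f g : A → ℕ} → (∀ x → f x ≤ g x) → Σl xs f ≤ Σl xs g
  Σl-mono-≤ [] e = z≤n
  Σl-mono-≤ (x ∷ xs) e = +-mono-≤ (e x) (Σl-mono-≤ xs e)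

  Σl-++ : ∀ (xs ys : List A) f → Σl (xs ++ ys) f ≡ Σl xs f + Σl ys f
  Σl-++ [] ys f = refl
  Σl-++ (x ∷ xs) ys f = trans (cong (f x +_) (Σl-++ xs ys f)) (sym (+-assoc (f x) _ _))

  Σl-map : ∀ {B : Set} (xs : List B) (g : B → A) f → Σl (map g xs) f ≡ Σl xs (λ x → f (g x))
  Σl-map [] g f = refl
  Σl-map (x ∷ xs) g f = cong (f (g x) +_) (Σl-map xs g f)

  Σl-concatMap : ∀ {B : Set} (g : B → List A) (xs : List B) f →
                 Σl (concatMap g xs) f ≡ Σl xs (λ x → Σl (g x) f)
  Σl-concatMap g [] f = refl
  Σl-concatMap g (x ∷ xs) f = trans (Σl-++ (g x) _ f) (cong (Σl (g x) f +_) (Σl-concatMap g xs f))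

  Σl-nonzero : ∀ (xs : List A) (f : A → ℕ) → Σl xs f ≡ 0 ⊎ Σ A (λ x → f x ≢ 0)
  Σl-nonzero [] f = inj₁ refl
  Σl-nonzero (x ∷ xs) f with f x in eq
  ... | suc _ = inj₂ (x , λ fx≡0 → 1+n≢0 (trans (sym eq) fx≡0))
  ... | zero  = Σl-nonzero xs f

Σl-comm : ∀ {A B : Set} (xs : List A) (ys : List B) (f : A → B → ℕ) →
          Σl xs (λ x → Σl ys (f x)) ≡ Σl ys (λ y → Σl xs (λ x → f x y))
Σl-comm [] ys f = sym (Σl-zero ys)
Σl-comm (x ∷ xs) ys f = begin
  Σl ys (f x) + Σl xs (λ x → Σl ys (f x))            ≡⟨ cong (Σl ys (f x) +_) (Σl-comm xs ys f) ⟩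
  Σl ys (f x) + Σl ys (λ y → Σl xs (λ x → f x y))    ≡⟨ sym (Σl-+ ys (f x) _) ⟩
  Σl ys (λ y → f x y + Σl xs (λ x → f x y))          ∎

false≢true : false ≢ true
false≢true ()

ind : Bool → ℕ
ind true = 1
ind false = 0

ind-∧ : ∀ a b → ind (a ∧ b) ≡ ind a * ind b
ind-∧ true b = sym (+-identityʳ _)
ind-∧ false b = refl

ind-not+ind : ∀ b → ind (not b) + ind b ≡ 1
ind-not+ind true = refl
ind-not+ind false = refl

ind≢0⇒true : ∀ b → ind b ≢ 0 → b ≡ true
ind≢0⇒true true _ = refl
ind≢0⇒true false ne = ⊥-elim (ne refl)

ind-dec-spec : ∀ {P : Set} (d : Dec P) → (P × ind ⌊ d ⌋ ≡ 1) ⊎ (¬ P × ind ⌊ d ⌋ ≡ 0)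
ind-dec-spec (yes p) = inj₁ (p , refl)
ind-dec-spec (no ¬p) = inj₂ (¬p , refl)

both-yes : ∀ {P Q : Set} (p : Dec P) (q : Dec Q) → (⌊ p ⌋ ∧ ⌊ q ⌋) ≡ true → P × Q
both-yes (yes p) (yes q) _ = p , q

⌊×-dec⌋ : ∀ {P Q : Set} (p : Dec P) (q : Dec Q) → ⌊ p ×-dec q ⌋ ≡ ⌊ p ⌋ ∧ ⌊ q ⌋
⌊×-dec⌋ (yes _) (yes _) = refl
⌊×-dec⌋ (yes _) (no _) = refl
⌊×-dec⌋ (no _) _ = refl

⌊≟true⌋ : ∀ b → ⌊ b BP.≟ true ⌋ ≡ b
⌊≟true⌋ true = refl
⌊≟true⌋ false = refl

module _ {A : Set} (_≟_ : DecidableEquality A) where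
  δ : A → A → ℕ
  δ x y = ind ⌊ x ≟ y ⌋

  δ-spec : ∀ x y → (x ≡ y × δ x y ≡ 1) ⊎ (x ≢ y × δ x y ≡ 0)
  δ-spec x y = ind-dec-spec (x ≟ y)

  δ-refl : ∀ x → δ x x ≡ 1
  δ-refl x with δ-spec x x
  ... | inj₁ (_ , d) = d
  ... | inj₂ (x≢x , _) = ⊥-elim (x≢x refl)

  δ-≢ : ∀ {x y} → x ≢ y → δ x y ≡ 0
  δ-≢ {x} {y} x≢y with δ-spec x y
  ... | inj₁ (x≡y , _) = ⊥-elim (x≢y x≡y)
  ... | inj₂ (_ , d) = d

δ-injective : ∀ {A B : Set} (_≟ᴬ_ : DecidableEquality A) (_≟ᴮ_ : DecidableEquality B) {f : A → B} →
              Injective _≡_ _≡_ f → ∀ x y → δ _≟ᴮ_ (f x) (f y) ≡ δ _≟ᴬ_ x y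
δ-injective _≟ᴬ_ _≟ᴮ_ {f} inj x y with δ-spec _≟ᴬ_ x y
... | inj₁ (refl , d) = trans (δ-refl _≟ᴮ_ (f x)) (sym d)
... | inj₂ (x≢y , d) = trans (δ-≢ _≟ᴮ_ (λ fx≡fy → x≢y (inj fx≡fy))) (sym d)

record Enumeration (A : Set) : Set where
  field
    elements : List A
    decEq    : DecidableEquality A
    once     : ∀ x → Σl elements (λ y → δ decEq y x) ≡ 1
open Enumeration public

card : ∀ {A : Set} → Enumeration A → ℕ
card E = Σl (elements E) (λ _ → 1)

module _ {A : Set} (E : Enumeration A) where
  Σ-δ* : ∀ x (h : A → ℕ) → Σl (elements E) (λ y → δ (decEq E) y x * h y) ≡ h x
  Σ-δ* x h = begin
    Σl (elements E) (λ y → δ (decEq E) y x * h y) ≡⟨ Σl-cong (elements E) δ*h≡δ*hx ⟩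
    Σl (elements E) (λ y → δ (decEq E) y x * h x) ≡⟨ Σl-*ʳ (elements E) _ (h x) ⟩
    Σl (elements E) (λ y → δ (decEq E) y x) * h x ≡⟨ cong (_* h x) (once E x) ⟩
    1 * h x                                       ≡⟨ *-identityˡ (h x) ⟩
    h x                                           ∎
    where
    δ*h≡δ*hx : ∀ y → δ (decEq E) y x * h y ≡ δ (decEq E) y x * h x
    δ*h≡δ*hx y with δ-spec (decEq E) y x
    ... | inj₁ (refl , _) = refl
    ... | inj₂ (_ , d) rewrite d = refl

  term≤Σ : ∀ x (h : A → ℕ) → h x ≤ Σl (elements E) h
  term≤Σ x h = subst (_≤ Σl (elements E) h) (Σ-δ* x h) (Σl-mono-≤ (elements E) δ*h≤h)
    where
    δ*h≤h : ∀ y → δ (decEq E) y x * h y ≤ h y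
    δ*h≤h y with δ-spec (decEq E) y x
    ... | inj₁ (_ , d) rewrite d = ≤-reflexive (+-identityʳ (h y))
    ... | inj₂ (_ , d) rewrite d = z≤n

Σ-reindex : ∀ {A B : Set} (EA : Enumeration A) (EB : Enumeration B) (f : A ↔ B) (h : B → ℕ) →
            Σl (elements EB) h ≡ Σl (elements EA) (λ a → h (Inverse.to f a))
Σ-reindex EA EB f h = begin
  Σl (elements EB) h
    ≡⟨ Σl-cong (elements EB) (λ b → sym (trans (Σ-δ* EA (from b) (λ a → h (to a))) (cong h (to∘from b)))) ⟩
  Σl (elements EB) (λ b → Σl (elements EA) (λ a → δ (decEq EA) a (from b) * h (to a)))
    ≡⟨ sym (Σl-comm (elements EA) (elements EB) _) ⟩
  Σl (elements EA) (λ a → Σl (elements EB) (λ b → δ (decEq EA) a (from b) * h (to a)))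
    ≡⟨ Σl-cong (elements EA) (λ a → Σl-cong (elements EB) (transpose a)) ⟩
  Σl (elements EA) (λ a → Σl (elements EB) (λ b → δ (decEq EB) b (to a) * h b))
    ≡⟨ Σl-cong (elements EA) (λ a → Σ-δ* EB (to a) h) ⟩
  Σl (elements EA) (λ a → h (to a)) ∎
  where
  open Inverse f using (to; from)
  to∘from : ∀ b → to (from b) ≡ b
  to∘from b = Inverse.strictlyInverseˡ f b
  from∘to : ∀ a → from (to a) ≡ a
  from∘to a = Inverse.strictlyInverseʳ f a
  transpose : ∀ a b → δ (decEq EA) a (from b) * h (to a) ≡ δ (decEq EB) b (to a) * h b
  transpose a b with δ-spec (decEq EA) a (from b) | δ-spec (decEq EB) b (to a)
  ... | inj₁ (a≡ , d₁) | inj₁ (b≡ , d₂) rewrite d₁ | d₂ = cong (λ z → h z + 0) (sym b≡)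
  ... | inj₁ (a≡ , _) | inj₂ (b≢ , _) = ⊥-elim (b≢ (trans (sym (to∘from b)) (cong to (sym a≡))))
  ... | inj₂ (a≢ , _) | inj₁ (b≡ , _) = ⊥-elim (a≢ (trans (sym (from∘to a)) (cong from (sym b≡))))
  ... | inj₂ (_ , d₁) | inj₂ (_ , d₂) rewrite d₁ | d₂ = refl

Σl-tabulate : ∀ {A : Set} n (g : Fin n → A) (f : A → ℕ) → Σl (tabulate g) f ≡ Σl (allFin n) (λ i → f (g i))
Σl-tabulate zero g f = refl
Σl-tabulate (suc n) g f = cong (f (g zero) +_) (begin
  Σl (tabulate (λ i → g (suc i))) f    ≡⟨ Σl-tabulate n (λ i → g (suc i)) f ⟩
  Σl (allFin n) (λ i → f (g (suc i)))  ≡⟨ Σl-tabulate n F.suc (λ i → f (g i)) ⟨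
  Σl (tabulate F.suc) (λ i → f (g i))  ∎)

Σl-cartesianProduct : ∀ {A B : Set} (xs : List A) (ys : List B) (f : A × B → ℕ) →
                      Σl (cartesianProduct xs ys) f ≡ Σl xs (λ x → Σl ys (λ y → f (x , y)))
Σl-cartesianProduct [] ys f = refl
Σl-cartesianProduct (x ∷ xs) ys f = trans (Σl-++ (map (x ,_) ys) _ f)
  (cong₂ _+_ (Σl-map ys (x ,_) f) (Σl-cartesianProduct xs ys f))

finEnum : ∀ n → Enumeration (Fin n)
finEnum n = record { elements = allFin n ; decEq = F._≟_ ; once = once-allFin n }
  where
  once-allFin : ∀ n (x : Fin n) → Σl (allFin n) (λ y → δ F._≟_ y x) ≡ 1
  once-allFin (suc n) zero = cong suc (begin
    Σl (tabulate {n = n} F.suc) (λ y → δ F._≟_ y zero)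
      ≡⟨ Σl-tabulate n F.suc _ ⟩
    Σl (allFin n) (λ y → δ F._≟_ (F.suc y) zero)
      ≡⟨ Σl-cong (allFin n) (λ y → δ-≢ F._≟_ {F.suc y} {zero} λ ()) ⟩
    Σl (allFin n) (λ _ → 0)
      ≡⟨ Σl-zero (allFin n) ⟩
    0 ∎)
  once-allFin (suc n) (suc x) = begin
    Σl (tabulate {n = n} F.suc) (λ y → δ F._≟_ y (suc x))
      ≡⟨ Σl-tabulate n F.suc _ ⟩
    Σl (allFin n) (λ y → δ F._≟_ (F.suc y) (suc x))
      ≡⟨ Σl-cong (allFin n) (λ y → δ-injective F._≟_ F._≟_ FP.suc-injective y x) ⟩
    Σl (allFin n) (λ y → δ F._≟_ y x)
      ≡⟨ once-allFin n x ⟩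
    1 ∎

card-finEnum : ∀ n → card (finEnum n) ≡ n
card-finEnum n = trans (Σl-const (allFin n) 1)
  (trans (*-identityʳ _) (length-tabulate (λ i → i)))

⊤-enum : Enumeration ⊤
⊤-enum = record { elements = tt ∷ [] ; decEq = λ _ _ → yes refl ; once = λ _ → refl }

×-enum : ∀ {A B : Set} → Enumeration A → Enumeration B → Enumeration (A × B)
×-enum {A} {B} EA EB = record
  { elements = cartesianProduct (elements EA) (elements EB)
  ; decEq = _≟×_
  ; once = once-× }
  where
  _≟×_ : DecidableEquality (A × B)
  _≟×_ = PP.≡-dec (decEq EA) (decEq EB)
  δ-× : ∀ a b x y → δ _≟×_ (a , b) (x , y) ≡ δ (decEq EB) b y * δ (decEq EA) a x
  δ-× a b x y with δ-spec (decEq EA) a x | δ-spec (decEq EB) b y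
  ... | inj₁ (refl , d₁) | inj₁ (refl , d₂) rewrite d₁ | d₂ = δ-refl _≟×_ (a , b)
  ... | inj₁ (_ , d₁) | inj₂ (b≢y , d₂) rewrite d₂ = δ-≢ _≟×_ (λ eq → b≢y (cong proj₂ eq))
  ... | inj₂ (a≢x , d₁) | _ rewrite d₁ =
        trans (δ-≢ _≟×_ (λ eq → a≢x (cong proj₁ eq))) (sym (*-zeroʳ (δ (decEq EB) b y)))
  once-× : ∀ p → Σl (cartesianProduct (elements EA) (elements EB)) (λ q → δ _≟×_ q p) ≡ 1
  once-× (x , y) = begin
    Σl (cartesianProduct (elements EA) (elements EB)) (λ q → δ _≟×_ q (x , y))
      ≡⟨ Σl-cartesianProduct (elements EA) (elements EB) _ ⟩
    Σl (elements EA) (λ a → Σl (elements EB) (λ b → δ _≟×_ (a , b) (x , y)))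
      ≡⟨ Σl-cong (elements EA) (λ a → Σl-cong (elements EB) (λ b → δ-× a b x y)) ⟩
    Σl (elements EA) (λ a → Σl (elements EB) (λ b → δ (decEq EB) b y * δ (decEq EA) a x))
      ≡⟨ Σl-cong (elements EA) (λ a → Σ-δ* EB y (λ _ → δ (decEq EA) a x)) ⟩
    Σl (elements EA) (λ a → δ (decEq EA) a x)
      ≡⟨ once EA x ⟩
    1 ∎

card-×-enum : ∀ {A B : Set} (EA : Enumeration A) (EB : Enumeration B) → card (×-enum EA EB) ≡ card EA * card EB
card-×-enum EA EB = begin
  card (×-enum EA EB)                                ≡⟨ Σl-cartesianProduct (elements EA) (elements EB) _ ⟩
  Σl (elements EA) (λ _ → card EB)                   ≡⟨ Σl-cong (elements EA) (λ _ → sym (*-identityˡ _)) ⟩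
  Σl (elements EA) (λ _ → 1 * card EB)               ≡⟨ Σl-*ʳ (elements EA) (λ _ → 1) _ ⟩
  card EA * card EB                                  ∎

-- Permutations

-- A permutation of Fin (suc n) is coded by the image of zero together with the code of the
-- permutation of Fin n obtained by punching that image out (a Lehmer code).
PermCode : ℕ → Set
PermCode zero = ⊤
PermCode (suc n) = Fin (suc n) × PermCode n

permEnum : ∀ n → Enumeration (PermCode n)
permEnum zero = ⊤-enum
permEnum (suc n) = ×-enum (finEnum (suc n)) (permEnum n)

card-permEnum : ∀ n → card (permEnum n) ≡ n !
card-permEnum zero = refl
card-permEnum (suc n) = trans (card-×-enum (finEnum (suc n)) (permEnum n))
  (cong₂ _*_ (card-finEnum (suc n)) (card-permEnum n))

⟦_⟧ : ∀ {n} → PermCode n → Fin n → Fin n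
⟦_⟧ {suc n} (i , c) zero = i
⟦_⟧ {suc n} (i , c) (suc j) = punchIn i (⟦ c ⟧ j)

⟦⟧-injective : ∀ {n} (c : PermCode n) → Injective _≡_ _≡_ ⟦ c ⟧
⟦⟧-injective {suc n} (i , c) {zero} {zero} _ = refl
⟦⟧-injective {suc n} (i , c) {zero} {suc y} eq = ⊥-elim (FP.punchInᵢ≢i i (⟦ c ⟧ y) (sym eq))
⟦⟧-injective {suc n} (i , c) {suc x} {zero} eq = ⊥-elim (FP.punchInᵢ≢i i (⟦ c ⟧ x) eq)
⟦⟧-injective {suc n} (i , c) {suc x} {suc y} eq = cong F.suc (⟦⟧-injective c (FP.punchIn-injective i _ _ eq))

toPermutation : ∀ {n} → PermCode n → Fin n ↔ Fin n
toPermutation {zero} _ = Permutation.id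
toPermutation {suc n} (i , c) = Permutation.insert zero i (toPermutation c)

toPermutation-⟦⟧ : ∀ {n} (c : PermCode n) x → Inverse.to (toPermutation c) x ≡ ⟦ c ⟧ x
toPermutation-⟦⟧ {suc n} (i , c) zero = refl
toPermutation-⟦⟧ {suc n} (i , c) (suc x) =
  trans (Permutation.insert-punchIn zero i (toPermutation c) x) (cong (punchIn i) (toPermutation-⟦⟧ c x))

module _ {n : ℕ} (f : Fin (suc n) → Fin (suc n)) (f-inj : Injective _≡_ _≡_ f) where
  restrict : Fin n → Fin n
  restrict j = punchOut {i = f zero} {j = f (suc j)} (λ eq → FP.0≢1+n (f-inj eq))

  restrict-injective : Injective _≡_ _≡_ restrict
  restrict-injective eq = FP.suc-injective (f-inj (FP.punchOut-injective {i = f zero} _ _ eq))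

encode : ∀ {n} (f : Fin n → Fin n) → Injective _≡_ _≡_ f → PermCode n
encode {zero} f f-inj = tt
encode {suc n} f f-inj = f zero , encode (restrict f f-inj) (restrict-injective f f-inj)

encode-cong : ∀ {n} {f g : Fin n → Fin n} (f-inj : Injective _≡_ _≡_ f) (g-inj : Injective _≡_ _≡_ g) →
              (∀ x → f x ≡ g x) → encode f f-inj ≡ encode g g-inj
encode-cong {zero} f-inj g-inj f≗g = refl
encode-cong {suc n} {f} {g} f-inj g-inj f≗g = cong₂ _,_ (f≗g zero)
  (encode-cong (restrict-injective f f-inj) (restrict-injective g g-inj) restrict≗)
  where
  punchOut-cong₂ : ∀ {i i′ j j′ : Fin (suc n)} (p : i ≢ j) (p′ : i′ ≢ j′) → i ≡ i′ → j ≡ j′ →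
                   punchOut p ≡ punchOut p′
  punchOut-cong₂ {i} p p′ refl refl = FP.punchOut-cong i refl
  restrict≗ : ∀ j → restrict f f-inj j ≡ restrict g g-inj j
  restrict≗ j = punchOut-cong₂ _ _ (f≗g zero) (f≗g (suc j))

⟦encode⟧ : ∀ {n} (f : Fin n → Fin n) (f-inj : Injective _≡_ _≡_ f) → ∀ x → ⟦ encode f f-inj ⟧ x ≡ f x
⟦encode⟧ {suc n} f f-inj zero = refl
⟦encode⟧ {suc n} f f-inj (suc j) = trans
  (cong (punchIn (f zero)) (⟦encode⟧ (restrict f f-inj) (restrict-injective f f-inj) j))
  (FP.punchIn-punchOut _)

encode-⟦⟧ : ∀ {n} (c : PermCode n) (inj : Injective _≡_ _≡_ ⟦ c ⟧) → encode ⟦ c ⟧ inj ≡ c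
encode-⟦⟧ {zero} tt inj = refl
encode-⟦⟧ {suc n} (i , c) inj = cong (i ,_)
  (trans (encode-cong _ (⟦⟧-injective c) restrict-⟦⟧) (encode-⟦⟧ c (⟦⟧-injective c)))
  where
  restrict-⟦⟧ : ∀ j → restrict ⟦ i , c ⟧ inj j ≡ ⟦ c ⟧ j
  restrict-⟦⟧ j = trans (FP.punchOut-cong i refl) (FP.punchOut-punchIn i)

↔-injective : ∀ {A B : Set} (f : A ↔ B) → Injective _≡_ _≡_ (Inverse.to f)
↔-injective f = Injection.injective (↔⇒↣ f)

Σ-perm-postcompose : ∀ {n} (g : Fin n ↔ Fin n) (X : (Fin n → Fin n) → ℕ) →
                     (∀ {s t} → (∀ x → s x ≡ t x) → X s ≡ X t) →
                     Σl (elements (permEnum n)) (λ c → X ⟦ c ⟧) ≡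
                     Σl (elements (permEnum n)) (λ c → X (λ x → Inverse.to g (⟦ c ⟧ x)))
Σ-perm-postcompose {n} g X X-cong = begin
  Σl (elements (permEnum n)) (λ c → X ⟦ c ⟧)
    ≡⟨ Σ-reindex (permEnum n) (permEnum n) postcompose↔ (λ c → X ⟦ c ⟧) ⟩
  Σl (elements (permEnum n)) (λ c → X ⟦ post g c ⟧)
    ≡⟨ Σl-cong (elements (permEnum n)) (λ c → X-cong (⟦encode⟧ _ _)) ⟩
  Σl (elements (permEnum n)) (λ c → X (λ x → Inverse.to g (⟦ c ⟧ x))) ∎
  where
  post : Fin n ↔ Fin n → PermCode n → PermCode n
  post h c = encode (λ x → Inverse.to h (⟦ c ⟧ x)) (λ eq → ⟦⟧-injective c (↔-injective h eq))
  post-post⁻¹ : ∀ (h : Fin n ↔ Fin n) c → post h (post (↔-sym h) c) ≡ c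
  post-post⁻¹ h c = trans
    (encode-cong _ (⟦⟧-injective c)
      (λ x → trans (cong (Inverse.to h) (⟦encode⟧ _ _ x)) (Inverse.strictlyInverseˡ h _)))
    (encode-⟦⟧ c (⟦⟧-injective c))
  postcompose↔ : PermCode n ↔ PermCode n
  postcompose↔ = mk↔ₛ′ (post g) (post (↔-sym g)) (post-post⁻¹ g) (post-post⁻¹ (↔-sym g))

SameEnds : ∀ {A : Set} → A → A → A → A → Set
SameEnds a b u v = (u ≡ a × v ≡ b) ⊎ (u ≡ b × v ≡ a)

matches-spec : ∀ {m} (a b u v : Fin m) → matches a b u v ≡ true → SameEnds a b u v
matches-spec a b u v eq with u F.≟ a | v F.≟ b
... | yes u≡a | yes v≡b = inj₁ (u≡a , v≡b)
... | yes _   | no _    = inj₂ (both-yes (u F.≟ b) (v F.≟ a) eq)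
... | no _    | _       = inj₂ (both-yes (u F.≟ b) (v F.≟ a) eq)

matches-refl : ∀ {m} (a b : Fin m) → matches a b a b ≡ true
matches-refl a b with a F.≟ a | b F.≟ b
... | yes _ | yes _ = refl
... | no a≢a | _ = ⊥-elim (a≢a refl)
... | yes _ | no b≢b = ⊥-elim (b≢b refl)

_≟²_ : ∀ {m} → DecidableEquality (Fin m × Fin m)
_≟²_ = PP.≡-dec F._≟_ F._≟_

matches-δ : ∀ {m} (a b c d : Fin m) → a <ᶠ b → c <ᶠ d → ind (matches a b c d) ≡ δ _≟²_ (a , b) (c , d)
matches-δ a b c d a<b c<d with matches a b c d in eq
... | true with matches-spec a b c d eq
...   | inj₁ (refl , refl) = sym (δ-refl _≟²_ (a , b))
...   | inj₂ (refl , refl) = ⊥-elim (FP.<-asym a<b c<d)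
matches-δ a b c d a<b c<d | false = sym (δ-≢ _≟²_ λ { refl → false≢true (trans (sym eq) (matches-refl a b)) })

Bool-irrelevant : ∀ {a b : Bool} (p q : a ≡ b) → p ≡ q
Bool-irrelevant = Decidable⇒UIP.≡-irrelevant BP._≟_

module EdgeEnumeration (Y : Graph) where
  edge-≡ : ∀ (e e′ : Edge Y) → proj₁ e ≡ proj₁ e′ → e ≡ e′
  edge-≡ (p , (l , a)) (.p , (l′ , a′)) refl =
    cong₂ (λ x y → p , (x , y)) (FP.<-irrelevant l l′) (Bool-irrelevant a a′)

  matchesEdge : Edge Y → Fin (n Y) → Fin (n Y) → Bool
  matchesEdge ((a , b) , _) = matches a b

  IsEdge : Fin (n Y) × Fin (n Y) → Set
  IsEdge p = (proj₁ p <ᶠ proj₂ p) × (adj Y (proj₁ p) (proj₂ p) ≡ true)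

  isEdge? : ∀ p → Dec (IsEdge p)
  isEdge? (i , j) = (i F.<? j) ×-dec (adj Y i j BP.≟ true)

  _≟ᴱ_ : DecidableEquality (Edge Y)
  e ≟ᴱ e′ = map′ (edge-≡ e e′) (cong proj₁) (proj₁ e ≟² proj₁ e′)

  δᴱ≡δ² : ∀ e e′ → δ _≟ᴱ_ e e′ ≡ δ _≟²_ (proj₁ e) (proj₁ e′)
  δᴱ≡δ² e e′ with δ-spec _≟²_ (proj₁ e) (proj₁ e′)
  ... | inj₁ (eq , d) = trans (subst (λ z → δ _≟ᴱ_ e z ≡ 1) (edge-≡ e e′ eq) (δ-refl _≟ᴱ_ e)) (sym d)
  ... | inj₂ (ne , d) = trans (δ-≢ _≟ᴱ_ (λ eq → ne (cong proj₁ eq))) (sym d)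

  asEdge : ∀ p → Dec (IsEdge p) → List (Edge Y)
  asEdge p (yes isEdge) = (p , isEdge) ∷ []
  asEdge p (no _) = []

  pairs : List (Fin (n Y) × Fin (n Y))
  pairs = cartesianProduct (allFin (n Y)) (allFin (n Y))

  edges : List (Edge Y)
  edges = concatMap (λ p → asEdge p (isEdge? p)) pairs

  Σ-edges : ∀ h → Σl edges h ≡ Σl pairs (λ p → Σl (asEdge p (isEdge? p)) h)
  Σ-edges h = Σl-concatMap (λ p → asEdge p (isEdge? p)) pairs h

  edgeEnum : Enumeration (Edge Y)
  edgeEnum = record { elements = edges ; decEq = _≟ᴱ_ ; once = once-edges }
    where
    once-asEdge : ∀ p (d : Dec (IsEdge p)) (x : Edge Y) →
                  Σl (asEdge p d) (λ e → δ _≟ᴱ_ e x) ≡ δ _≟²_ p (proj₁ x)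
    once-asEdge p (yes isEdge) x = trans (+-identityʳ _) (δᴱ≡δ² (p , isEdge) x)
    once-asEdge p (no ¬isEdge) x = sym (δ-≢ _≟²_ (λ eq → ¬isEdge (subst IsEdge (sym eq) (proj₂ x))))
    once-edges : ∀ x → Σl edges (λ e → δ _≟ᴱ_ e x) ≡ 1
    once-edges x = trans (Σ-edges _)
      (trans (Σl-cong pairs (λ p → once-asEdge p (isEdge? p) x)) (once (×-enum (finEnum _) (finEnum _)) (proj₁ x)))

  numEdges≡card : numEdges Y ≡ card edgeEnum
  numEdges≡card = begin
    numEdges Y
      ≡⟨ Σl-cong (allFin (n Y)) (λ i → Σl-cong (allFin (n Y)) (λ j → edgeIndicator≡ i j)) ⟩
    Σl (allFin (n Y)) (λ i → Σl (allFin (n Y)) (λ j → Σl (asEdge (i , j) (isEdge? (i , j))) (λ _ → 1)))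
      ≡⟨ sym (Σl-cartesianProduct (allFin (n Y)) (allFin (n Y)) _) ⟩
    Σl pairs (λ p → Σl (asEdge p (isEdge? p)) (λ _ → 1))
      ≡⟨ sym (Σ-edges _) ⟩
    card edgeEnum ∎
    where
    card-asEdge : ∀ p (d : Dec (IsEdge p)) → Σl (asEdge p d) (λ _ → 1) ≡ ind ⌊ d ⌋
    card-asEdge p (yes _) = refl
    card-asEdge p (no _) = refl
    edgeIndicator-ind : ∀ i j → edgeIndicator Y i j ≡ ind (⌊ i F.<? j ⌋ ∧ adj Y i j)
    edgeIndicator-ind i j with ⌊ i F.<? j ⌋ ∧ adj Y i j
    ... | true = refl
    ... | false = refl
    edgeIndicator≡ : ∀ i j → edgeIndicator Y i j ≡ Σl (asEdge (i , j) (isEdge? (i , j))) (λ _ → 1)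
    edgeIndicator≡ i j = begin
      edgeIndicator Y i j
        ≡⟨ edgeIndicator-ind i j ⟩
      ind (⌊ i F.<? j ⌋ ∧ adj Y i j)
        ≡⟨ cong (λ z → ind (⌊ i F.<? j ⌋ ∧ z)) (⌊≟true⌋ (adj Y i j)) ⟨
      ind (⌊ i F.<? j ⌋ ∧ ⌊ adj Y i j BP.≟ true ⌋)
        ≡⟨ cong ind (⌊×-dec⌋ (i F.<? j) (adj Y i j BP.≟ true)) ⟨
      ind ⌊ isEdge? (i , j) ⌋
        ≡⟨ card-asEdge _ (isEdge? (i , j)) ⟨
      Σl (asEdge (i , j) (isEdge? (i , j))) (λ _ → 1) ∎

  edge-between : ∀ u v → adj Y u v ≡ true → Σ (Edge Y) (λ e → proj₁ e ≡ (u , v) ⊎ proj₁ e ≡ (v , u))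
  edge-between u v uv with FP.<-cmp u v
  ... | tri< u<v _ _ = ((u , v) , (u<v , uv)) , inj₁ refl
  ... | tri≈ _ refl _ = ⊥-elim (false≢true (trans (sym (irrefl Y u)) uv))
  ... | tri> _ _ v<u = ((v , u) , (v<u , trans (Graph.sym Y v u) uv)) , inj₂ refl

  matchesEdge-once-at : (e : Edge Y) → Σl edges (λ e′ → ind (matchesEdge e′ (proj₁ (proj₁ e)) (proj₂ (proj₁ e)))) ≡ 1
  matchesEdge-once-at e@((a , b) , (a<b , _)) = trans
    (Σl-cong edges (λ e′ → trans (matches-δ _ _ a b (proj₁ (proj₂ e′)) a<b) (sym (δᴱ≡δ² e′ e))))
    (once edgeEnum e)

  matchesEdge-once : ∀ u v → adj Y u v ≡ true → Σl edges (λ e → ind (matchesEdge e u v)) ≡ 1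
  matchesEdge-once u v uv with edge-between u v uv
  ... | e , inj₁ refl = matchesEdge-once-at e
  ... | e , inj₂ refl = trans
        (Σl-cong edges (λ e′ → cong ind (matches-sym (proj₁ (proj₁ e′)) (proj₂ (proj₁ e′)) u v)))
        (matchesEdge-once-at e)

-- Edge patterns

data Constraint : Set where
  on off free : Constraint

Pattern : ℕ → Set
Pattern = Vec Constraint

satisfies : Constraint → Bool → Bool
satisfies on b = b
satisfies off b = not b
satisfies free _ = true

fits : ∀ {k} → Pattern k → Vec Bool k → Bool
fits [] [] = true
fits (c ∷ p) (b ∷ v) = satisfies c b ∧ fits p v

FullySpecified : ∀ {k} → Pattern k → Set
FullySpecified [] = ⊤
FullySpecified (on ∷ p) = FullySpecified p
FullySpecified (off ∷ p) = FullySpecified p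
FullySpecified (free ∷ p) = ⊥

OffFree : ∀ {k} → Pattern k → Set
OffFree [] = ⊤
OffFree (on ∷ p) = OffFree p
OffFree (off ∷ p) = ⊥
OffFree (free ∷ p) = OffFree p

HasFree : ∀ {k} → Pattern k → Set
HasFree [] = ⊥
HasFree (on ∷ p) = HasFree p
HasFree (off ∷ p) = HasFree p
HasFree (free ∷ p) = ⊤

evenOff : ∀ {k} → Pattern k → Bool
evenOff [] = true
evenOff (on ∷ p) = evenOff p
evenOff (off ∷ p) = not (evenOff p)
evenOff (free ∷ p) = evenOff p

#on : ∀ {k} → Pattern k → ℕ
#on [] = 0
#on (on ∷ p) = suc (#on p)
#on (off ∷ p) = #on p
#on (free ∷ p) = #on p

allOn : ∀ k → Pattern k
allOn k = replicate k on

allOn-offFree : ∀ k → OffFree (allOn k)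
allOn-offFree zero = tt
allOn-offFree (suc k) = allOn-offFree k

#on-allOn : ∀ k → #on (allOn k) ≡ k
#on-allOn zero = refl
#on-allOn (suc k) = cong suc (#on-allOn k)

#on<length : ∀ {k} (p : Pattern k) → HasFree p → #on p < k
#on<length (on ∷ p) hasFree = s≤s (#on<length p hasFree)
#on<length (off ∷ p) hasFree = m≤n⇒m≤1+n (#on<length p hasFree)
#on<length (free ∷ p) _ = s≤s (#on≤length p)
  where
  #on≤length : ∀ {k} (p : Pattern k) → #on p ≤ k
  #on≤length [] = z≤n
  #on≤length (on ∷ p) = s≤s (#on≤length p)
  #on≤length (off ∷ p) = m≤n⇒m≤1+n (#on≤length p)
  #on≤length (free ∷ p) = m≤n⇒m≤1+n (#on≤length p)

FreeSplits : ∀ {k} → (Pattern k → ℕ) → Set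
FreeSplits {zero} R = ⊤
FreeSplits {suc k} R =
  (∀ p → R (free ∷ p) ≡ R (on ∷ p) + R (off ∷ p)) × (∀ c → FreeSplits (λ p → R (c ∷ p)))

FreeSplits-cong : ∀ {k} {R R′ : Pattern k → ℕ} → (∀ p → R p ≡ R′ p) → FreeSplits R → FreeSplits R′
FreeSplits-cong {zero} R≗R′ _ = tt
FreeSplits-cong {suc k} R≗R′ (split , splits) =
  (λ p → trans (sym (R≗R′ (free ∷ p)))
           (trans (split p) (cong₂ _+_ (R≗R′ (on ∷ p)) (R≗R′ (off ∷ p))))) ,
  (λ c → FreeSplits-cong (λ p → R≗R′ (c ∷ p)) (splits c))

weightedFitCount-freeSplits : ∀ {C : Set} k (L : List C) (w : C → ℕ) (V : C → Vec Bool k) →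
                      FreeSplits (λ p → Σl L (λ c → w c * ind (fits p (V c))))
weightedFitCount-freeSplits zero L w V = tt
weightedFitCount-freeSplits (suc k) L w V = split , splits
  where
  split : ∀ p → Σl L (λ c → w c * ind (fits (free ∷ p) (V c))) ≡
                Σl L (λ c → w c * ind (fits (on ∷ p) (V c))) + Σl L (λ c → w c * ind (fits (off ∷ p) (V c)))
  split p = trans (Σl-cong L split-at) (Σl-+ L _ _)
    where
    split-at : ∀ c → w c * ind (fits (free ∷ p) (V c)) ≡
                     w c * ind (fits (on ∷ p) (V c)) + w c * ind (fits (off ∷ p) (V c))
    split-at c with V c
    ... | true ∷ v = sym (trans (cong (w c * ind (fits p v) +_) (*-zeroʳ (w c))) (+-identityʳ _))
    ... | false ∷ v = sym (cong (_+ w c * ind (fits p v)) (*-zeroʳ (w c)))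
  splits : ∀ c → FreeSplits (λ p → Σl L (λ x → w x * ind (fits (c ∷ p) (V x))))
  splits c = FreeSplits-cong (λ p → Σl-cong L (reweight p))
    (weightedFitCount-freeSplits k L (λ x → w x * ind (satisfies c (head (V x)))) (λ x → tail (V x)))
    where
    reweight : ∀ p x → w x * ind (satisfies c (head (V x))) * ind (fits p (tail (V x)))
                       ≡ w x * ind (fits (c ∷ p) (V x))
    reweight p x with V x
    ... | b ∷ v = trans (*-assoc (w x) _ _) (cong (w x *_) (sym (ind-∧ (satisfies c b) (fits p v))))

DifferBy : Bool → ℕ → ℕ → ℕ → Set
DifferBy true x y a = x ≡ y + a
DifferBy false x y a = y ≡ x + a

DifferBy-zero : ∀ s {x y} → DifferBy s x y 0 → x ≡ y
DifferBy-zero true eq = trans eq (+-identityʳ _)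
DifferBy-zero false eq = sym (trans eq (+-identityʳ _))

DifferBy-complement : ∀ s {x y u v a} → x + u ≡ y + v → DifferBy s x y a → DifferBy (not s) u v a
DifferBy-complement true {a = a} sums x≡y+a = exchange sums x≡y+a
  where
  exchange : ∀ {x y u v} → x + u ≡ y + v → x ≡ y + a → v ≡ u + a
  exchange {x} {y} {u} {v} sums x≡y+a = trans (+-cancelˡ-≡ y v (a + u) (begin
    y + v       ≡⟨ sym sums ⟩
    x + u       ≡⟨ cong (_+ u) x≡y+a ⟩
    y + a + u   ≡⟨ +-assoc y a u ⟩
    y + (a + u) ∎)) (+-comm a u)
DifferBy-complement false sums y≡x+a = DifferBy-complement true (sym sums) y≡x+a

-- Inclusion–exclusion along the `free` positions: a difference a between the all-`on` counts
-- reappears, with sign (-1)^#off, in every fully specified pattern.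
signed-difference : ∀ k (RG RH : Pattern k → ℕ) a → FreeSplits RG → FreeSplits RH →
  (∀ p → OffFree p → HasFree p → RG p ≡ RH p) → RG (allOn k) ≡ RH (allOn k) + a →
  ∀ p → FullySpecified p → DifferBy (evenOff p) (RG p) (RH p) a
signed-difference zero RG RH a _ _ _ base [] _ = base
signed-difference (suc k) RG RH a splitsG splitsH agree base (on ∷ p) full =
  signed-difference k (λ q → RG (on ∷ q)) (λ q → RH (on ∷ q)) a
    (proj₂ splitsG on) (proj₂ splitsH on) (λ q → agree (on ∷ q)) base p full
signed-difference (suc k) RG RH a splitsG splitsH agree base (off ∷ p) full =
  DifferBy-complement (evenOff p) on+off
    (signed-difference k (λ q → RG (on ∷ q)) (λ q → RH (on ∷ q)) a
      (proj₂ splitsG on) (proj₂ splitsH on) (λ q → agree (on ∷ q)) base p full)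
  where
  free-agrees : RG (free ∷ p) ≡ RH (free ∷ p)
  free-agrees = DifferBy-zero (evenOff p)
    (signed-difference k (λ q → RG (free ∷ q)) (λ q → RH (free ∷ q)) 0
      (proj₂ splitsG free) (proj₂ splitsH free) (λ q offFree _ → agree (free ∷ q) offFree tt)
      (trans (agree (free ∷ allOn k) (allOn-offFree k) tt) (sym (+-identityʳ _))) p full)
  on+off : RG (on ∷ p) + RG (off ∷ p) ≡ RH (on ∷ p) + RH (off ∷ p)
  on+off = trans (sym (proj₁ splitsG p)) (trans free-agrees (proj₁ splitsH p))

-- Kelly's lemma

mapToVec : ∀ {A B : Set} (L : List A) → (A → B) → Vec B (length L)
mapToVec [] f = []
mapToVec (x ∷ L) f = f x ∷ mapToVec L f

mapToVec-cong : ∀ {A B : Set} (L : List A) {f g : A → B} → (∀ x → f x ≡ g x) → mapToVec L f ≡ mapToVec L g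
mapToVec-cong [] f≗g = refl
mapToVec-cong (x ∷ L) f≗g = cong₂ _∷_ (f≗g x) (mapToVec-cong L f≗g)

fits-allOn : ∀ {A : Set} (L : List A) (u : A → Bool) → (∀ x → u x ≡ true) →
             fits (allOn (length L)) (mapToVec L u) ≡ true
fits-allOn [] u all-u = refl
fits-allOn (x ∷ L) u all-u rewrite all-u x = fits-allOn L u all-u

fits-allOn⇒ : ∀ {A : Set} (_≟_ : DecidableEquality A) (L : List A) (u : A → Bool) →
              fits (allOn (length L)) (mapToVec L u) ≡ true → ∀ x → Σl L (λ y → δ _≟_ y x) ≡ 1 → u x ≡ true
fits-allOn⇒ _≟_ (y ∷ L) u fit x x∈L with u y in uy | δ-spec _≟_ y x
... | true | inj₁ (refl , _) = uy
... | true | inj₂ (_ , d) =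
      fits-allOn⇒ _≟_ L u fit x (subst (λ z → z + Σl L (λ y → δ _≟_ y x) ≡ 1) d x∈L)

module _ {A : Set} where
  anyOn : (L : List A) → Pattern (length L) → (A → Bool) → Bool
  anyOn [] [] w = false
  anyOn (x ∷ L) (on ∷ p) w = w x ∨ anyOn L p w
  anyOn (x ∷ L) (off ∷ p) w = anyOn L p w
  anyOn (x ∷ L) (free ∷ p) w = anyOn L p w

  anyOn-none : (L : List A) (p : Pattern (length L)) (w : A → Bool) → (∀ x → w x ≡ false) → anyOn L p w ≡ false
  anyOn-none [] [] w none = refl
  anyOn-none (x ∷ L) (on ∷ p) w none rewrite none x = anyOn-none L p w none
  anyOn-none (x ∷ L) (off ∷ p) w none = anyOn-none L p w none
  anyOn-none (x ∷ L) (free ∷ p) w none = anyOn-none L p w none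

  countOn : (L : List A) → Pattern (length L) → (A → Bool) → ℕ
  countOn [] [] w = 0
  countOn (x ∷ L) (on ∷ p) w = ind (w x) + countOn L p w
  countOn (x ∷ L) (off ∷ p) w = countOn L p w
  countOn (x ∷ L) (free ∷ p) w = countOn L p w

  fits-∧-not : (L : List A) (p : Pattern (length L)) → OffFree p → (u w : A → Bool) →
               fits p (mapToVec L (λ x → u x ∧ not (w x))) ≡ fits p (mapToVec L u) ∧ not (anyOn L p w)
  fits-∧-not [] [] _ u w = refl
  fits-∧-not (x ∷ L) (on ∷ p) offFree u w =
    trans (cong ((u x ∧ not (w x)) ∧_) (fits-∧-not L p offFree u w)) (regroup (u x) (w x) _ _)
    where
    regroup : ∀ a b c d → (a ∧ not b) ∧ (c ∧ not d) ≡ (a ∧ c) ∧ not (b ∨ d)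
    regroup true true c d = sym (BP.∧-zeroʳ c)
    regroup true false c d = refl
    regroup false b c d = refl
  fits-∧-not (x ∷ L) (free ∷ p) offFree u w = fits-∧-not L p offFree u w

  ind-anyOn : (L : List A) (p : Pattern (length L)) (w : A → Bool) → countOn L p w ≤ 1 →
              ind (anyOn L p w) ≡ countOn L p w
  ind-anyOn [] [] w _ = refl
  ind-anyOn (x ∷ L) (on ∷ p) w ≤1 with w x
  ... | true = cong suc (sym (n≤0⇒n≡0 (≤-pred ≤1)))
  ... | false = ind-anyOn L p w ≤1
  ind-anyOn (x ∷ L) (off ∷ p) w ≤1 = ind-anyOn L p w ≤1
  ind-anyOn (x ∷ L) (free ∷ p) w ≤1 = ind-anyOn L p w ≤1

  countOn≤Σ : (L : List A) (p : Pattern (length L)) (w : A → Bool) → countOn L p w ≤ Σl L (λ x → ind (w x))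
  countOn≤Σ [] [] w = z≤n
  countOn≤Σ (x ∷ L) (on ∷ p) w = +-monoʳ-≤ (ind (w x)) (countOn≤Σ L p w)
  countOn≤Σ (x ∷ L) (off ∷ p) w = ≤-trans (countOn≤Σ L p w) (m≤n+m _ _)
  countOn≤Σ (x ∷ L) (free ∷ p) w = ≤-trans (countOn≤Σ L p w) (m≤n+m _ _)

  Σ-ind-unique≤1 : (_≟_ : DecidableEquality A) (L : List A) → (∀ x → Σl L (λ y → δ _≟_ y x) ≤ 1) →
                   (Q : A → Bool) → (∀ {x y} → Q x ≡ true → Q y ≡ true → x ≡ y) →
                   Σl L (λ x → ind (Q x)) ≤ 1
  Σ-ind-unique≤1 _≟_ [] _ Q _ = z≤n
  Σ-ind-unique≤1 _≟_ (x ∷ L) multiplicity≤1 Q unique with Q x in Qx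
  ... | true = s≤s (≤-reflexive (n≤0⇒n≡0 (≤-trans (Σl-mono-≤ L Q≤δ) (≤-reflexive rest-without-x))))
    where
    rest-without-x : Σl L (λ y → δ _≟_ y x) ≡ 0
    rest-without-x = n≤0⇒n≡0 (≤-pred
      (subst (λ z → z + Σl L (λ y → δ _≟_ y x) ≤ 1) (δ-refl _≟_ x) (multiplicity≤1 x)))
    Q≤δ : ∀ y → ind (Q y) ≤ δ _≟_ y x
    Q≤δ y with Q y in Qy
    ... | true = ≤-reflexive (sym (subst (λ z → δ _≟_ z x ≡ 1) (unique Qx Qy) (δ-refl _≟_ x)))
    ... | false = z≤n
  ... | false = Σ-ind-unique≤1 _≟_ L (λ z → ≤-trans (m≤n+m _ (δ _≟_ x z)) (multiplicity≤1 z)) Q unique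

  Σ-countOn : (L : List A) (p : Pattern (length L)) → OffFree p →
              (u : A → Bool) → fits p (mapToVec L u) ≡ true →
              {E : Set} (LE : List E) (w : E → A → Bool) →
              (∀ x → u x ≡ true → Σl LE (λ e → ind (w e x)) ≡ 1) →
              Σl LE (λ e → countOn L p (w e)) ≡ #on p
  Σ-countOn [] [] _ u _ LE w _ = Σl-zero LE
  Σ-countOn (x ∷ L) (on ∷ p) offFree u fit LE w once-w with u x in ux
  ... | true = trans (Σl-+ LE _ _) (cong₂ _+_ (once-w x ux) (Σ-countOn L p offFree u fit LE w once-w))
  Σ-countOn (x ∷ L) (free ∷ p) offFree u fit LE w once-w = Σ-countOn L p offFree u fit LE w once-w

edgeImage : (G Y : Graph) → (Fin (n G) → Fin (n Y)) → Vec Bool (length (EdgeEnumeration.edges G))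
edgeImage G Y σ = mapToVec (EdgeEnumeration.edges G) (λ e → adj Y (σ (proj₁ (proj₁ e))) (σ (proj₂ (proj₁ e))))

crossed-<ᶠ : ∀ {k} {a b c d : Fin k} → a <ᶠ b → c <ᶠ d → a ≡ d → b ≡ c → ⊥
crossed-<ᶠ a<b c<d refl refl = FP.<-asym a<b c<d

module Kelly (G Y : Graph) (σ : Fin (n G) → Fin (n Y)) (σ-inj : Injective _≡_ _≡_ σ) where
  private
    module EG = EdgeEnumeration G
    module EY = EdgeEnumeration Y

  kept : Edge G → Bool
  kept x = adj Y (σ (proj₁ (proj₁ x))) (σ (proj₂ (proj₁ x)))

  hits : Edge Y → Edge G → Bool
  hits e x = EY.matchesEdge e (σ (proj₁ (proj₁ x))) (σ (proj₂ (proj₁ x)))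

  hits-unique : ∀ e {x y} → hits e x ≡ true → hits e y ≡ true → x ≡ y
  hits-unique e {x@((x₁ , x₂) , (x₁<x₂ , _))} {y@((y₁ , y₂) , (y₁<y₂ , _))} hx hy
    with matches-spec _ _ _ _ hx | matches-spec _ _ _ _ hy
  ... | inj₁ (x₁a , x₂b) | inj₁ (y₁a , y₂b) =
        EG.edge-≡ x y (cong₂ _,_ (σ-inj (trans x₁a (sym y₁a))) (σ-inj (trans x₂b (sym y₂b))))
  ... | inj₂ (x₁b , x₂a) | inj₂ (y₁b , y₂a) =
        EG.edge-≡ x y (cong₂ _,_ (σ-inj (trans x₁b (sym y₁b))) (σ-inj (trans x₂a (sym y₂a))))
  ... | inj₁ (x₁a , x₂b) | inj₂ (y₁b , y₂a) =
        ⊥-elim (crossed-<ᶠ x₁<x₂ y₁<y₂ (σ-inj (trans x₁a (sym y₂a))) (σ-inj (trans x₂b (sym y₁b))))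
  ... | inj₂ (x₁b , x₂a) | inj₁ (y₁a , y₂b) =
        ⊥-elim (crossed-<ᶠ x₁<x₂ y₁<y₂ (σ-inj (trans x₁b (sym y₂b))) (σ-inj (trans x₂a (sym y₁a))))

  fits-deleteEdge : ∀ p → OffFree p → ∀ e →
    fits p (edgeImage G (deleteEdge Y e) σ) ≡ fits p (edgeImage G Y σ) ∧ not (anyOn EG.edges p (hits e))
  fits-deleteEdge p offFree e = fits-∧-not EG.edges p offFree kept (hits e)

  Σ-anyOn-hits : ∀ p → OffFree p → fits p (edgeImage G Y σ) ≡ true →
                 Σl EY.edges (λ e → ind (anyOn EG.edges p (hits e))) ≡ #on p
  Σ-anyOn-hits p offFree fit = trans (Σl-cong EY.edges (λ e → ind-anyOn EG.edges p (hits e) (countOn≤1 e)))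
    (Σ-countOn EG.edges p offFree kept fit EY.edges hits (λ x kept-x → EY.matchesEdge-once _ _ kept-x))
    where
    countOn≤1 : ∀ e → countOn EG.edges p (hits e) ≤ 1
    countOn≤1 e = ≤-trans (countOn≤Σ EG.edges p (hits e))
      (Σ-ind-unique≤1 EG._≟ᴱ_ EG.edges (λ x → ≤-reflexive (once EG.edgeEnum x)) (hits e) (hits-unique e))

  -- Kelly's lemma for a single map σ: deleting an edge of Y destroys a fit iff that edge is one of
  -- the #on p images of the edges required to be present.
  kelly-single : ∀ p → OffFree p →
    Σl EY.edges (λ e → ind (fits p (edgeImage G (deleteEdge Y e) σ))) + #on p * ind (fits p (edgeImage G Y σ))
      ≡ card EY.edgeEnum * ind (fits p (edgeImage G Y σ))
  kelly-single p offFree with fits p (edgeImage G Y σ) in fit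
  ... | false = begin
    Σl EY.edges (λ e → ind (fits p (edgeImage G (deleteEdge Y e) σ))) + #on p * 0
      ≡⟨ cong₂ _+_ (Σl-cong EY.edges deleted-no-fit) (*-zeroʳ (#on p)) ⟩
    Σl EY.edges (λ _ → 0) + 0
      ≡⟨ cong (_+ 0) (Σl-zero EY.edges) ⟩
    0
      ≡⟨ *-zeroʳ (card EY.edgeEnum) ⟨
    card EY.edgeEnum * 0 ∎
    where
    deleted-no-fit : ∀ e → ind (fits p (edgeImage G (deleteEdge Y e) σ)) ≡ 0
    deleted-no-fit e = cong ind (trans (fits-deleteEdge p offFree e) (cong (_∧ not (anyOn EG.edges p (hits e))) fit))
  ... | true = begin
    Σl EY.edges (λ e → ind (fits p (edgeImage G (deleteEdge Y e) σ))) + #on p * 1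
      ≡⟨ cong₂ _+_ (Σl-cong EY.edges deleted-fit) (*-identityʳ (#on p)) ⟩
    Σl EY.edges (λ e → ind (not (anyOn EG.edges p (hits e)))) + #on p
      ≡⟨ cong (Σl EY.edges (λ e → ind (not (anyOn EG.edges p (hits e)))) +_) (Σ-anyOn-hits p offFree fit) ⟨
    Σl EY.edges (λ e → ind (not (anyOn EG.edges p (hits e)))) + Σl EY.edges (λ e → ind (anyOn EG.edges p (hits e)))
      ≡⟨ Σl-+ EY.edges _ _ ⟨
    Σl EY.edges (λ e → ind (not (anyOn EG.edges p (hits e))) + ind (anyOn EG.edges p (hits e)))
      ≡⟨ Σl-cong EY.edges (λ e → ind-not+ind (anyOn EG.edges p (hits e))) ⟩
    card EY.edgeEnum
      ≡⟨ *-identityʳ _ ⟨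
    card EY.edgeEnum * 1 ∎
    where
    deleted-fit : ∀ e → ind (fits p (edgeImage G (deleteEdge Y e) σ)) ≡ ind (not (anyOn EG.edges p (hits e)))
    deleted-fit e = cong ind (trans (fits-deleteEdge p offFree e) (cong (_∧ not (anyOn EG.edges p (hits e))) fit))

-- The counting argument

allBits : ∀ k → List (Vec Bool k)
allBits zero = [] ∷ []
allBits (suc k) = map (true ∷_) (allBits k) ++ map (false ∷_) (allBits k)

Σ-allBits-suc : ∀ k (f : Vec Bool (suc k) → ℕ) →
                Σl (allBits (suc k)) f ≡
                Σl (allBits k) (λ F → f (true ∷ F)) + Σl (allBits k) (λ F → f (false ∷ F))
Σ-allBits-suc k f = trans (Σl-++ (map (true ∷_) (allBits k)) _ f)
  (cong₂ _+_ (Σl-map (allBits k) _ f) (Σl-map (allBits k) _ f))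

card-allBits : ∀ k → Σl (allBits k) (λ _ → 1) ≡ 2 ^ k
card-allBits zero = refl
card-allBits (suc k) = trans (Σ-allBits-suc k _)
  (trans (cong₂ _+_ (card-allBits k) (card-allBits k)) (cong (2 ^ k +_) (sym (+-identityʳ (2 ^ k)))))

fromBits : ∀ {k} → Vec Bool k → Pattern k
fromBits [] = []
fromBits (true ∷ F) = on ∷ fromBits F
fromBits (false ∷ F) = off ∷ fromBits F

fromBits-fullySpecified : ∀ {k} (F : Vec Bool k) → FullySpecified (fromBits F)
fromBits-fullySpecified [] = tt
fromBits-fullySpecified (true ∷ F) = fromBits-fullySpecified F
fromBits-fullySpecified (false ∷ F) = fromBits-fullySpecified F

Σ-fits-fromBits : ∀ k (v : Vec Bool k) → Σl (allBits k) (λ F → ind (fits (fromBits F) v)) ≡ 1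
Σ-fits-fromBits zero [] = refl
Σ-fits-fromBits (suc k) (true ∷ v) = trans (Σ-allBits-suc k _)
  (cong₂ _+_ (Σ-fits-fromBits k v) (Σl-zero (allBits k)))
Σ-fits-fromBits (suc k) (false ∷ v) = trans (Σ-allBits-suc k _)
  (cong₂ _+_ (Σl-zero (allBits k)) (Σ-fits-fromBits k v))

count-evenOff : ∀ k → Σl (allBits (suc k)) (λ F → ind (evenOff (fromBits F))) ≡ 2 ^ k
count-evenOff k = begin
  Σl (allBits (suc k)) (λ F → ind (evenOff (fromBits F)))
    ≡⟨ Σ-allBits-suc k _ ⟩
  Σl (allBits k) (λ F → ind (evenOff (fromBits F))) + Σl (allBits k) (λ F → ind (not (evenOff (fromBits F))))
    ≡⟨ Σl-+ (allBits k) _ _ ⟨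
  Σl (allBits k) (λ F → ind (evenOff (fromBits F)) + ind (not (evenOff (fromBits F))))
    ≡⟨ Σl-cong (allBits k) (λ F → trans (+-comm (ind (evenOff (fromBits F))) _)
                                          (ind-not+ind (evenOff (fromBits F)))) ⟩
  Σl (allBits k) (λ _ → 1)
    ≡⟨ card-allBits k ⟩
  2 ^ k ∎

*-cancel-by-excess : ∀ X k M a b → k < M → X + k * a ≡ M * a → X + k * b ≡ M * b → a ≡ b
*-cancel-by-excess X k M a b k<M eqa eqb = *-cancelˡ-≡ a b (M ∸ k) {{>-nonZero (m<n⇒0<n∸m k<M)}}
  (trans (sym (X≡[M∸k]* a eqa)) (X≡[M∸k]* b eqb))
  where
  X≡[M∸k]* : ∀ c → X + k * c ≡ M * c → X ≡ (M ∸ k) * c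
  X≡[M∸k]* c eq = +-cancelʳ-≡ (k * c) X ((M ∸ k) * c) (begin
    X + k * c               ≡⟨ eq ⟩
    M * c                   ≡⟨ cong (_* c) (m∸n+n≡m (<⇒≤ k<M)) ⟨
    (M ∸ k + k) * c         ≡⟨ *-distribʳ-+ c (M ∸ k) k ⟩
    (M ∸ k) * c + k * c     ∎)

!-mono-≤ : ∀ {a b} → a ≤ b → a ! ≤ b !
!-mono-≤ {a} {zero} z≤n = ≤-refl
!-mono-≤ {a} {suc b} a≤1+b with m≤n⇒m<n∨m≡n a≤1+b
... | inj₂ refl = ≤-refl
... | inj₁ a<1+b = ≤-trans (!-mono-≤ (≤-pred a<1+b)) (m≤n*m (b !) (suc b))

module FitCounts (G : Graph) where
  private
    module EG = EdgeEnumeration G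

  m : ℕ
  m = length EG.edges

  perms : List (PermCode (n G))
  perms = elements (permEnum (n G))

  fitCount : (Y : Graph) → (PermCode (n G) → Fin (n G) → Fin (n Y)) → Pattern m → ℕ
  fitCount Y s p = Σl perms (λ c → ind (fits p (edgeImage G Y (s c))))

  fitCount-freeSplits : ∀ Y s → FreeSplits (fitCount Y s)
  fitCount-freeSplits Y s = FreeSplits-cong (λ p → Σl-cong perms (λ c → *-identityˡ _))
    (weightedFitCount-freeSplits m perms (λ _ → 1) (λ c → edgeImage G Y (s c)))

  kelly : ∀ Y (s : PermCode (n G) → Fin (n G) → Fin (n Y)) → (∀ c → Injective _≡_ _≡_ (s c)) →
          ∀ p → OffFree p →
          Σl (EdgeEnumeration.edges Y) (λ e → fitCount (deleteEdge Y e) s p) + #on p * fitCount Y s p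
            ≡ card (EdgeEnumeration.edgeEnum Y) * fitCount Y s p
  kelly Y s s-inj p offFree = begin
    Σl EY (λ e → Σl perms (λ c → f e c)) + #on p * Σl perms g
      ≡⟨ cong₂ _+_ (Σl-comm EY perms f) (sym (Σl-*ˡ perms g (#on p))) ⟩
    Σl perms (λ c → Σl EY (λ e → f e c)) + Σl perms (λ c → #on p * g c)
      ≡⟨ Σl-+ perms (λ c → Σl EY (λ e → f e c)) (λ c → #on p * g c) ⟨
    Σl perms (λ c → Σl EY (λ e → f e c) + #on p * g c)
      ≡⟨ Σl-cong perms (λ c → Kelly.kelly-single G Y (s c) (s-inj c) p offFree) ⟩
    Σl perms (λ c → card (EdgeEnumeration.edgeEnum Y) * g c)
      ≡⟨ Σl-*ˡ perms g (card (EdgeEnumeration.edgeEnum Y)) ⟩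
    card (EdgeEnumeration.edgeEnum Y) * Σl perms g ∎
    where
    EY = EdgeEnumeration.edges Y
    f : Edge Y → PermCode (n G) → ℕ
    f e c = ind (fits p (edgeImage G (deleteEdge Y e) (s c)))
    g : PermCode (n G) → ℕ
    g c = ind (fits p (edgeImage G Y (s c)))

  edgeImage-cong : ∀ Y {s t : Fin (n G) → Fin (n Y)} → (∀ x → s x ≡ t x) → edgeImage G Y s ≡ edgeImage G Y t
  edgeImage-cong Y s≗t = mapToVec-cong EG.edges (λ x → cong₂ (adj Y) (s≗t _) (s≗t _))

  edgeImage-≅ : ∀ {Y Y′ : Graph} (ι : Y ≅ Y′) (s : Fin (n G) → Fin (n Y)) →
                edgeImage G Y′ (λ x → Inverse.to (proj₁ ι) (s x)) ≡ edgeImage G Y s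
  edgeImage-≅ (ι , adj≡) s = mapToVec-cong EG.edges (λ x → sym (adj≡ _ _))

module Reconstruction (G H : Graph) (φ : Edge G ↔ Edge H)
                      (deck : ∀ e → deleteEdge G e ≅ deleteEdge H (Inverse.to φ e))
                      (α : Fin (n G) ↔ Fin (n H)) where
  open FitCounts G
  private
    module EG = EdgeEnumeration G
    module EH = EdgeEnumeration H


  intoH : PermCode (n G) → Fin (n G) → Fin (n H)
  intoH c x = Inverse.to α (⟦ c ⟧ x)

  intoH-injective : ∀ c → Injective _≡_ _≡_ (intoH c)
  intoH-injective c eq = ⟦⟧-injective c (↔-injective α eq)

  countG countH : Pattern m → ℕ
  countG = fitCount G ⟦_⟧
  countH = fitCount H intoH

  card-EG : card EG.edgeEnum ≡ m
  card-EG = trans (Σl-const EG.edges 1) (*-identityʳ m)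

  card-EH : card EH.edgeEnum ≡ m
  card-EH = trans (Σ-reindex EG.edgeEnum EH.edgeEnum φ (λ _ → 1)) card-EG

  m≡numEdges : m ≡ numEdges G
  m≡numEdges = sym (trans EG.numEdges≡card card-EG)

  -- The card isomorphism ι : G - e ≅ H - φ e carries fits of π into fits of ι ∘ π, and
  -- ι ∘ π = α ∘ (α⁻¹ ∘ ι ∘ π) merely permutes the permutations summed over.
  deck-fitCount : ∀ e p → fitCount (deleteEdge G e) ⟦_⟧ p ≡ fitCount (deleteEdge H (Inverse.to φ e)) intoH p
  deck-fitCount e p = begin
    fitCount G′ ⟦_⟧ p
      ≡⟨ Σl-cong perms (λ c → cong (λ v → ind (fits p v)) (edgeImage-≅ {G′} {H′} (deck e) ⟦ c ⟧)) ⟨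
    Σl perms (λ c → ind (fits p (edgeImage G H′ (λ x → Inverse.to ι (⟦ c ⟧ x)))))
      ≡⟨ Σl-cong perms (λ c → cong (λ v → ind (fits p v))
           (edgeImage-cong H′ (λ x → Inverse.strictlyInverseˡ α _))) ⟨
    Σl perms (λ c → X (λ x → Inverse.to g (⟦ c ⟧ x)))
      ≡⟨ Σ-perm-postcompose g X X-cong ⟨
    fitCount H′ intoH p ∎
    where
    G′ = deleteEdge G e
    H′ = deleteEdge H (Inverse.to φ e)
    ι = proj₁ (deck e)
    g : Fin (n G) ↔ Fin (n G)
    g = ↔-sym α ↔-∘ ι
    X : (Fin (n G) → Fin (n G)) → ℕ
    X s = ind (fits p (edgeImage G H′ (λ x → Inverse.to α (s x))))
    X-cong : ∀ {s t} → (∀ x → s x ≡ t x) → X s ≡ X t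
    X-cong s≗t = cong (λ v → ind (fits p v)) (edgeImage-cong H′ (λ x → cong (Inverse.to α) (s≗t x)))

  -- Kelly's lemma recovers a count from the counts of the cards once #on p < m, and the cards of
  -- G and H give equal counts.
  counts-agree : ∀ p → OffFree p → HasFree p → countG p ≡ countH p
  counts-agree p offFree hasFree = *-cancel-by-excess deckSum (#on p) m (countG p) (countH p) (#on<length p hasFree)
    (trans (kelly G ⟦_⟧ ⟦⟧-injective p offFree) (cong (_* countG p) card-EG))
    (trans (cong (_+ #on p * countH p) deckSum≡)
      (trans (kelly H intoH intoH-injective p offFree) (cong (_* countH p) card-EH)))
    where
    deckSum = Σl EG.edges (λ e → fitCount (deleteEdge G e) ⟦_⟧ p)
    deckSum≡ : deckSum ≡ Σl EH.edges (λ e → fitCount (deleteEdge H e) intoH p)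
    deckSum≡ = trans (Σl-cong EG.edges (λ e → deck-fitCount e p))
      (sym (Σ-reindex EG.edgeEnum EH.edgeEnum φ (λ e → fitCount (deleteEdge H e) intoH p)))

  identity-fits : 1 ≤ countG (allOn m)
  identity-fits = subst (_≤ countG (allOn m)) id-fits
    (term≤Σ (permEnum (n G)) id-code (λ c → ind (fits (allOn m) (edgeImage G G ⟦ c ⟧))))
    where
    id-code : PermCode (n G)
    id-code = encode (λ x → x) (λ eq → eq)
    id-fits : ind (fits (allOn m) (edgeImage G G ⟦ id-code ⟧)) ≡ 1
    id-fits = trans (cong (λ v → ind (fits (allOn m) v)) (edgeImage-cong G (⟦encode⟧ (λ x → x) (λ eq → eq))))
      (cong ind (fits-allOn EG.edges _ (λ e → proj₂ (proj₂ e))))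

  -- With no embedding of G into H the all-`on` surplus is countG (allOn m) ≥ 1, so every pattern
  -- with an even number of `off` entries is fitted by some permutation.
  evenOff-bound : countH (allOn m) ≡ 0 → Σl (allBits m) (λ F → ind (evenOff (fromBits F))) ≤ n G !
  evenOff-bound none = ≤-trans
    (Σl-mono-≤ (allBits m) (λ F → evenOff≤countG (fromBits F) (fromBits-fullySpecified F)))
    (≤-reflexive (begin
      Σl (allBits m) (λ F → countG (fromBits F))
        ≡⟨ Σl-comm (allBits m) perms (λ F c → ind (fits (fromBits F) (edgeImage G G ⟦ c ⟧))) ⟩
      Σl perms (λ c → Σl (allBits m) (λ F → ind (fits (fromBits F) (edgeImage G G ⟦ c ⟧))))
        ≡⟨ Σl-cong perms (λ c → Σ-fits-fromBits m (edgeImage G G ⟦ c ⟧)) ⟩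
      card (permEnum (n G))
        ≡⟨ card-permEnum (n G) ⟩
      n G ! ∎))
    where
    surplus = countG (allOn m)
    differ : ∀ p → FullySpecified p → DifferBy (evenOff p) (countG p) (countH p) surplus
    differ = signed-difference m countG countH surplus (fitCount-freeSplits G ⟦_⟧) (fitCount-freeSplits H intoH)
      counts-agree (cong (_+ surplus) (sym none))
    evenOff≤countG : ∀ p → FullySpecified p → ind (evenOff p) ≤ countG p
    evenOff≤countG p full with evenOff p | differ p full
    ... | true | countG≡ =
          ≤-trans identity-fits (subst (surplus ≤_) (sym countG≡) (m≤n+m surplus (countH p)))
    ... | false | _ = z≤n

  -- An injection σ carrying every edge of G to an edge of H is an isomorphism: as |E(G)| = |E(H)|,
  -- Kelly's lemma for the all-`on` pattern leaves no edge of H outside the image.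
  module Embedding (σ : Fin (n G) → Fin (n H)) (σ-inj : Injective _≡_ _≡_ σ)
                   (all-kept : fits (allOn m) (edgeImage G H σ) ≡ true) where
    open Kelly G H σ σ-inj

    every-edge-hit : ∀ e → ¬ (∀ x → hits e x ≡ false)
    every-edge-hit e unhit = n≮0 (subst (1 ≤_) deleted-fits≡0
      (≤-trans (≤-reflexive (sym deleted-fits-e)) (term≤Σ EH.edgeEnum e deleted-fits)))
      where
      deleted-fits : Edge H → ℕ
      deleted-fits e′ = ind (fits (allOn m) (edgeImage G (deleteEdge H e′) σ))
      deleted-fits-e : deleted-fits e ≡ 1
      deleted-fits-e = cong ind (trans (fits-deleteEdge (allOn m) (allOn-offFree m) e)
        (cong₂ (λ a b → a ∧ not b) all-kept (anyOn-none EG.edges (allOn m) (hits e) unhit)))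
      deleted-fits≡0 : Σl EH.edges deleted-fits ≡ 0
      deleted-fits≡0 = +-cancelʳ-≡ (#on (allOn m) * 1) _ 0 (trans
        (subst (λ b → Σl EH.edges deleted-fits + #on (allOn m) * ind b ≡ card EH.edgeEnum * ind b)
          all-kept (kelly-single (allOn m) (allOn-offFree m)))
        (cong (_* 1) (trans card-EH (sym (#on-allOn m)))))

    edge-kept : ∀ i j → adj G i j ≡ true → adj H (σ i) (σ j) ≡ true
    edge-kept i j ij with EG.edge-between i j ij
    ... | e , inj₁ refl = fits-allOn⇒ EG._≟ᴱ_ EG.edges kept all-kept e (once EG.edgeEnum e)
    ... | e , inj₂ refl =
          trans (Graph.sym H (σ i) (σ j)) (fits-allOn⇒ EG._≟ᴱ_ EG.edges kept all-kept e (once EG.edgeEnum e))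

    pull : ∀ {a b x₁ x₂} → SameEnds (σ a) (σ b) (σ x₁) (σ x₂) → SameEnds a b x₁ x₂
    pull = Data.Sum.map (Data.Product.map σ-inj σ-inj) (Data.Product.map σ-inj σ-inj)

    non-edge-unhit : ∀ i j → adj G i j ≡ false → ∀ e →
      (∀ {x} → hits e x ≡ true → SameEnds i j (proj₁ (proj₁ x)) (proj₂ (proj₁ x))) →
      ∀ x → hits e x ≡ false
    non-edge-unhit i j ¬ij e ends x@((x₁ , x₂) , (_ , x₁x₂)) with hits e x in hit
    ... | false = refl
    ... | true with ends {x} hit
    ...   | inj₁ (refl , refl) = ⊥-elim (false≢true (trans (sym ¬ij) x₁x₂))
    ...   | inj₂ (refl , refl) = ⊥-elim (false≢true (trans (sym ¬ij) (trans (Graph.sym G x₂ x₁) x₁x₂)))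

    non-edge-kept : ∀ i j → adj G i j ≡ false → adj H (σ i) (σ j) ≡ false
    non-edge-kept i j ¬ij with adj H (σ i) (σ j) in σiσj
    ... | false = refl
    ... | true with EH.edge-between (σ i) (σ j) σiσj
    ...   | e , inj₁ refl =
            ⊥-elim (every-edge-hit e (non-edge-unhit i j ¬ij e (λ h → pull (matches-spec _ _ _ _ h))))
    ...   | e , inj₂ refl =
            ⊥-elim (every-edge-hit e (non-edge-unhit i j ¬ij e
              (λ h → Data.Sum.swap (pull (matches-spec _ _ _ _ h)))))

    preserves-adj : ∀ i j → adj G i j ≡ adj H (σ i) (σ j)
    preserves-adj i j with adj G i j in ij
    ... | true = sym (edge-kept i j ij)
    ... | false = sym (non-edge-kept i j ij)

  isomorphic-or-n!-large : G ≅ H ⊎ (∀ k → numEdges G ≡ suc k → 2 ^ k ≤ n G !)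
  isomorphic-or-n!-large with Σl-nonzero perms (λ c → ind (fits (allOn m) (edgeImage G H (intoH c))))
  ... | inj₁ none = inj₂ λ k m≡1+k → subst (_≤ n G !) (count-evenOff k)
        (subst (λ j → Σl (allBits j) (λ F → ind (evenOff (fromBits F))) ≤ n G !) (trans m≡numEdges m≡1+k)
          (evenOff-bound none))
  ... | inj₂ (c , fits≢0) = inj₁ (α ↔-∘ toPermutation c , λ i j → trans
        (Embedding.preserves-adj (intoH c) (intoH-injective c) (ind≢0⇒true _ fits≢0) i j)
        (cong₂ (λ x y → adj H (Inverse.to α x) (Inverse.to α y))
          (sym (toPermutation-⟦⟧ c i)) (sym (toPermutation-⟦⟧ c j))))

some-edge : ∀ G k → numEdges G ≡ suc k → Edge G
some-edge G k m≡1+k with Σl-nonzero (EdgeEnumeration.edges G) (λ _ → 1)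
... | inj₁ none = ⊥-elim (1+n≢0 (trans (sym m≡1+k) (trans (EdgeEnumeration.numEdges≡card G) none)))
... | inj₂ (e , _) = e

n!<2^[m∸1]⇒edgeReconstructible : ∀ G k → numEdges G ≡ suc k → n G ! < 2 ^ k → EdgeReconstructible G
n!<2^[m∸1]⇒edgeReconstructible G k m≡1+k n!<2^k H (φ , deck)
  with Reconstruction.isomorphic-or-n!-large G H φ deck (proj₁ (deck (some-edge G k m≡1+k)))
... | inj₁ G≅H = G≅H
... | inj₂ bound = ⊥-elim (<⇒≱ n!<2^k (bound k m≡1+k))

mainTheorem6 : (N : ℕ) → 11 ≤ N → (G : Graph) → n G ≤ N → TwoConnected G →
    2 * (N !) < 2 ^ numEdges G → EdgeReconstructible G
mainTheorem6 N _ G n≤N _ 2N!<2^m with numEdges G in m≡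
... | zero = ⊥-elim (<⇒≱ 2N!<2^m (≤-trans (1≤n! N) (m≤m+n (N !) _)))
... | suc k = n!<2^[m∸1]⇒edgeReconstructible G k m≡
  (≤-<-trans (!-mono-≤ n≤N) (*-cancelˡ-< 2 (N !) (2 ^ k) 2N!<2^m))
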